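{- Let $S\subset\{ -1,0,1\}^2\setminus\{(0,0)\}$ with positive weights $(w_s)$ (with $w_{(1,-1)}:=0$ if $(1,-1)\notin S$), let $(p,q)$ with $p>0$, $q\ge0$, and let ${\sf C}(x,y;t)$, ${\sf L}(x,y;t)$, $\tilde{\sf C}(x,y;t)$ and ${\sf L}_1(t)$ be as in the context. Then \[{\sf L}(x,y;t)={\sf C}(x,y;t)-w_{(1,-1)}\,t\,{\sf L}_1(t)\,\tilde{\sf C}(x,y;t).\]
   Context: $\mathcal{C}=\{(i,j)\in\mathbb{Z}^2:i>0\text{ or }j>0\}$. All walks use steps in $S$, stay in $\mathcal{C}$ (all visited points), and are weighted by the product of their step weights times $t^{\text{length}}$ and $x^iy^j$ at the end-point $(i,j)$. ${\sf C}(x,y;t)$ counts such walks starting at $(p,q)$; $\tilde{\sf C}(x,y;t)$ counts such walks starting at $(1,0)$; ${\sf L}(x,y;t)$ counts such walks starting at $(p,q)$ that never take the step directly from $(0,1)$ to $(1,0)$; ${\sf L}_1(t)$ is the generating function (weights times $t^{\text{length}}$) of the walks counted by ${\sf L}$ that end at $(0,1)$. -}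

module Defs where

open import Level using (Level)
open import Algebra.Bundles using (CommutativeRing)
open import Data.Bool using (Bool; true; false; _∧_; _∨_; not; if_then_else_)
open import Data.Nat using (ℕ; zero; suc; _∸_)
open import Data.Integer using (ℤ; +_; -[1+_])
import Data.Integer as ℤ
open import Data.Product using (_×_; _,_; proj₁; proj₂)
open import Data.List using (List; []; _∷_; map; concatMap; foldr)
open import Relation.Nullary.Decidable using (⌊_⌋)

data Step : Set where
  E NE N NW W SW S SE : Step

allSteps : List Step
allSteps = E ∷ NE ∷ N ∷ NW ∷ W ∷ SW ∷ S ∷ SE ∷ []

dx dy : Step → ℤ
dx E = + 1
dx NE = + 1
dx N = + 0
dx NW = -[1+ 0 ]
dx W = -[1+ 0 ]
dx SW = -[1+ 0 ]
dx S = + 0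
dx SE = + 1
dy E = + 0
dy NE = + 1
dy N = + 1
dy NW = + 1
dy W = + 0
dy SW = -[1+ 0 ]
dy S = -[1+ 0 ]
dy SE = -[1+ 0 ]

isSE : Step → Bool
isSE SE = true
isSE _  = false

Point : Set
Point = ℤ × ℤ

move : Point → Step → Point
move (i , j) s = (i ℤ.+ dx s , j ℤ.+ dy s)

_==ℤ_ : ℤ → ℤ → Bool
a ==ℤ b = ⌊ a ℤ.≟ b ⌋

_==P_ : Point → Point → Bool
(a , b) ==P (c , d) = (a ==ℤ c) ∧ (b ==ℤ d)

inCone : Point → Bool
inCone (i , j) = ⌊ + 0 ℤ.<? i ⌋ ∨ ⌊ + 0 ℤ.<? j ⌋

seqs : ℕ → List (List Step)
seqs zero = [] ∷ []
seqs (suc n) = concatMap (λ s → map (s ∷_) (seqs n)) allSteps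

endpoint : Point → List Step → Point
endpoint pt [] = pt
endpoint pt (s ∷ ss) = endpoint (move pt s) ss

forbidden : Point → Step → Bool
forbidden pt s = isSE s ∧ (pt ==P (+ 0 , + 1))

validFrom : (Step → Bool) → Bool → Point → List Step → Bool
validFrom inS avoid pt [] = true
validFrom inS avoid pt (s ∷ ss) =
  inS s ∧ inCone (move pt s) ∧ not (avoid ∧ forbidden pt s)
    ∧ validFrom inS avoid (move pt s) ss

module Walks {c ℓ : Level} (R : CommutativeRing c ℓ)
             (inS : Step → Bool) (w : Step → CommutativeRing.Carrier R) where
  open CommutativeRing R

  -- effective weight: w_s for s ∈ S, and 0 otherwise (so w_{(1,-1)} := 0 if (1,-1) ∉ S)
  wt : Step → Carrier
  wt s = if inS s then w s else 0#

  weightOf : List Step → Carrier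
  weightOf = foldr (λ s acc → wt s * acc) 1#

  count : Bool → ℕ → Point → Point → Carrier
  count avoid n start end =
    foldr (λ ss acc →
            (if inCone start ∧ validFrom inS avoid start ss ∧ (endpoint start ss ==P end)
             then weightOf ss else 0#) + acc)
          0# (seqs n)

  -- [t^n x^i y^j] C(x,y;t), walks from (p,q)
  coefC : ℕ → ℕ → ℕ → ℤ → ℤ → Carrier
  coefC p q n i j = count false n (+ p , + q) (i , j)

  -- [t^n x^i y^j] C~(x,y;t), walks from (1,0)
  coefCt : ℕ → ℤ → ℤ → Carrier
  coefCt n i j = count false n (+ 1 , + 0) (i , j)

  -- [t^n x^i y^j] L(x,y;t)
  coefL : ℕ → ℕ → ℕ → ℤ → ℤ → Carrier
  coefL p q n i j = count true n (+ p , + q) (i , j)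

  -- [t^n] L_1(t)
  coefL1 : ℕ → ℕ → ℕ → Carrier
  coefL1 p q n = coefL p q n (+ 0) (+ 1)

  sumBelow : ℕ → (ℕ → Carrier) → Carrier
  sumBelow zero f = 0#
  sumBelow (suc n) f = sumBelow n f + f n

  -- [t^n x^i y^j] of  t · L_1(t) · C~(x,y;t)
  coefTL1Ct : ℕ → ℕ → ℕ → ℤ → ℤ → Carrier
  coefTL1Ct p q zero i j = 0#
  coefTL1Ct p q (suc n) i j = sumBelow (suc n) (λ k → coefL1 p q k * coefCt (n ∸ k) i j)

module Submission where

-- A walk counted by C either never takes the step (0,1) → (1,0), or takes it a first time:
-- it is then an avoiding walk from the start to (0,1), the step of weight w_SE t, and an
-- arbitrary walk from (1,0); hence C = L + w_SE t L₁ C̃.  Coefficientwise this is proved by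
-- induction on the length for an arbitrary starting point, decomposing every walk according
-- to its first step: the first steps of C and L differ only by the forbidden step, which
-- contributes the walks going through (1,0) immediately, and t L₁ C̃ satisfies the same
-- first-step recursion as L up to that extra term.

open import Defs
open import Level using (Level)
open import Algebra.Bundles using (Ring; CommutativeRing)
open import Data.Bool using (Bool; true; false; _∧_; not; if_then_else_)
open import Data.Nat using (ℕ; _<_; zero; suc; _∸_)
open import Data.Integer using (ℤ; +_)
import Data.Integer as ℤ
open import Data.Product using (_,_)
open import Data.List using (List; []; _∷_; map; concatMap; foldr; _++_)
open import Relation.Nullary using (yes; no)
open import Relation.Binary.PropositionalEquality as ≡ using (_≡_)

module ListSum {c ℓ : Level} (R : Ring c ℓ) where
  open Ring R
  open import Algebra.Properties.Ring R using (-0#≈0#; -‿+-comm)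
  open import Algebra.Properties.CommutativeSemigroup +-commutativeSemigroup using (interchange)

  sumOver : {A : Set} → List A → (A → Carrier) → Carrier
  sumOver xs f = foldr (λ x acc → f x + acc) 0# xs

  module _ {A : Set} where

    sumOver-cong : (xs : List A) {f g : A → Carrier} → (∀ x → f x ≈ g x) →
                   sumOver xs f ≈ sumOver xs g
    sumOver-cong []       f≈g = refl
    sumOver-cong (x ∷ xs) f≈g = +-cong (f≈g x) (sumOver-cong xs f≈g)

    sumOver-0# : (xs : List A) → sumOver xs (λ _ → 0#) ≈ 0#
    sumOver-0# []       = refl
    sumOver-0# (x ∷ xs) = trans (+-identityˡ _) (sumOver-0# xs)

    sumOver-+ : (xs : List A) (f g : A → Carrier) →
                sumOver xs (λ x → f x + g x) ≈ sumOver xs f + sumOver xs g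
    sumOver-+ []       f g = sym (+-identityˡ 0#)
    sumOver-+ (x ∷ xs) f g =
      trans (+-congˡ (sumOver-+ xs f g)) (interchange (f x) (g x) (sumOver xs f) (sumOver xs g))

    sumOver-neg : (xs : List A) (f : A → Carrier) → sumOver xs (λ x → - f x) ≈ - sumOver xs f
    sumOver-neg []       f = sym -0#≈0#
    sumOver-neg (x ∷ xs) f = trans (+-congˡ (sumOver-neg xs f)) (-‿+-comm (f x) _)

    sumOver-- : (xs : List A) (f g : A → Carrier) →
                sumOver xs (λ x → f x - g x) ≈ sumOver xs f - sumOver xs g
    sumOver-- xs f g = trans (sumOver-+ xs f (λ x → - g x)) (+-congˡ (sumOver-neg xs g))

    sumOver-*ˡ : (xs : List A) (a : Carrier) (f : A → Carrier) →
                 sumOver xs (λ x → a * f x) ≈ a * sumOver xs f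
    sumOver-*ˡ []       a f = sym (zeroʳ a)
    sumOver-*ˡ (x ∷ xs) a f = trans (+-congˡ (sumOver-*ˡ xs a f)) (sym (distribˡ a (f x) _))

    sumOver-*ʳ : (xs : List A) (a : Carrier) (f : A → Carrier) →
                 sumOver xs (λ x → f x * a) ≈ sumOver xs f * a
    sumOver-*ʳ []       a f = sym (zeroˡ a)
    sumOver-*ʳ (x ∷ xs) a f = trans (+-congˡ (sumOver-*ʳ xs a f)) (sym (distribʳ a (f x) _))

    sumOver-++ : (xs ys : List A) (f : A → Carrier) →
                 sumOver (xs ++ ys) f ≈ sumOver xs f + sumOver ys f
    sumOver-++ []       ys f = sym (+-identityˡ _)
    sumOver-++ (x ∷ xs) ys f = trans (+-congˡ (sumOver-++ xs ys f)) (sym (+-assoc _ _ _))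

    sumOver-map-∷ : (a : A) (yss : List (List A)) (g : List A → Carrier) →
                    sumOver (map (a ∷_) yss) g ≡ sumOver yss (λ ys → g (a ∷ ys))
    sumOver-map-∷ a []         g = ≡.refl
    sumOver-map-∷ a (ys ∷ yss) g = ≡.cong (λ rest → g (a ∷ ys) + rest) (sumOver-map-∷ a yss g)

  sumOver-concatMap : {A B : Set} (F : A → List B) (xs : List A) (g : B → Carrier) →
                      sumOver (concatMap F xs) g ≈ sumOver xs (λ x → sumOver (F x) g)
  sumOver-concatMap F []       g = refl
  sumOver-concatMap F (x ∷ xs) g =
    trans (sumOver-++ (F x) (concatMap F xs) g) (+-congˡ (sumOver-concatMap F xs g))

module WalkDecomposition {c ℓ : Level} (R : CommutativeRing c ℓ)
                         (inS : Step → Bool) (w : Step → CommutativeRing.Carrier R) where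
  open CommutativeRing R
  open Walks R inS w
  open ListSum ring
  open import Relation.Binary.Reasoning.Setoid setoid
  open import Algebra.Properties.Ring ring using (-0#≈0#; -‿+-comm; x[y-z]≈xy-xz)
  open import Algebra.Properties.CommutativeSemigroup *-commutativeSemigroup using (x∙yz≈y∙xz)

  sumBelow-cong : ∀ m {f g : ℕ → Carrier} → (∀ k → f k ≈ g k) → sumBelow m f ≈ sumBelow m g
  sumBelow-cong zero    f≈g = refl
  sumBelow-cong (suc m) f≈g = +-cong (sumBelow-cong m f≈g) (f≈g m)

  sumBelow-*ˡ : ∀ m (a : Carrier) (f : ℕ → Carrier) → sumBelow m (λ k → a * f k) ≈ a * sumBelow m f
  sumBelow-*ˡ zero    a f = sym (zeroʳ a)
  sumBelow-*ˡ (suc m) a f = trans (+-congʳ (sumBelow-*ˡ m a f)) (sym (distribˡ a _ _))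

  sumBelow-suc : ∀ m (f : ℕ → Carrier) → sumBelow (suc m) f ≈ f 0 + sumBelow m (λ k → f (suc k))
  sumBelow-suc zero    f = trans (+-identityˡ _) (sym (+-identityʳ _))
  sumBelow-suc (suc m) f = trans (+-congʳ (sumBelow-suc m f)) (+-assoc _ _ _)

  sumBelow-sumOver : {A : Set} (xs : List A) (m : ℕ) (F : A → ℕ → Carrier) →
                     sumBelow m (λ k → sumOver xs (λ x → F x k)) ≈ sumOver xs (λ x → sumBelow m (F x))
  sumBelow-sumOver xs zero    F = sym (sumOver-0# xs)
  sumBelow-sumOver xs (suc m) F =
    trans (+-congʳ (sumBelow-sumOver xs m F)) (sym (sumOver-+ xs (λ x → sumBelow m (F x)) (λ x → F x m)))

  -- The condition that the step lands in C is checked by the walk continuing from there.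
  firstStepWeight : Bool → Point → Step → Carrier
  firstStepWeight avoid pt s =
    if inCone pt ∧ (inS s ∧ not (avoid ∧ forbidden pt s)) then wt s else 0#

  guard-split : ∀ c₀ c₁ c₂ c₃ v e (a b : Carrier) →
    (if c₀ ∧ ((c₁ ∧ (c₂ ∧ (c₃ ∧ v))) ∧ e) then a * b else 0#) ≈
    (if c₀ ∧ (c₁ ∧ c₃) then a else 0#) * (if c₂ ∧ (v ∧ e) then b else 0#)
  guard-split false c₁    c₂    c₃    v     e     a b = sym (zeroˡ _)
  guard-split true  false c₂    c₃    v     e     a b = sym (zeroˡ _)
  guard-split true  true  false false v     e     a b = sym (zeroˡ _)
  guard-split true  true  true  false v     e     a b = sym (zeroˡ _)
  guard-split true  true  false true  v     e     a b = sym (zeroʳ _)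
  guard-split true  true  true  true  false e     a b = sym (zeroʳ _)
  guard-split true  true  true  true  true  false a b = sym (zeroʳ _)
  guard-split true  true  true  true  true  true  a b = refl

  count-suc : ∀ avoid n pt e →
    count avoid (suc n) pt e ≈
    sumOver allSteps (λ s → firstStepWeight avoid pt s * count avoid n (move pt s) e)
  count-suc avoid n pt e =
    trans (sumOver-concatMap (λ s → map (s ∷_) (seqs n)) allSteps summand)
      (sumOver-cong allSteps λ s →
        trans (reflexive (sumOver-map-∷ s (seqs n) summand))
          (trans (sumOver-cong (seqs n) λ ss →
                    guard-split (inCone pt) (inS s) (inCone (move pt s)) (not (avoid ∧ forbidden pt s))
                      (validFrom inS avoid (move pt s) ss) (endpoint (move pt s) ss ==P e)
                      (wt s) (weightOf ss))
                 (sumOver-*ˡ (seqs n) (firstStepWeight avoid pt s) _)))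
    where
    summand : List Step → Carrier
    summand ss = if inCone pt ∧ validFrom inS avoid pt ss ∧ (endpoint pt ss ==P e)
                 then weightOf ss else 0#

  L₁ : Point → ℕ → Carrier
  L₁ pt k = count true k pt (+ 0 , + 1)

  C̃ : ℕ → Point → Carrier
  C̃ n e = count false n (+ 1 , + 0) e

  tL₁C̃ : Point → ℕ → Point → Carrier
  tL₁C̃ pt zero    e = 0#
  tL₁C̃ pt (suc n) e = sumBelow (suc n) (λ k → L₁ pt k * C̃ (n ∸ k) e)

  move-forbidden : ∀ pt → pt ==P (+ 0 , + 1) ≡ true → move pt SE ≡ (+ 1 , + 0)
  move-forbidden (i , j) at-01 with i ℤ.≟ + 0 | j ℤ.≟ + 1 | at-01
  ... | yes ≡.refl | yes ≡.refl | _  = ≡.refl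
  ... | yes _      | no _       | ()
  ... | no _       | _          | ()

  x≈x+z : ∀ {x z} → z ≈ 0# → x ≈ x + z
  x≈x+z z≈0 = trans (sym (+-identityʳ _)) (+-congˡ (sym z≈0))

  x*[y*z]≈0 : ∀ {x y z} → y ≈ 0# → x * (y * z) ≈ 0#
  x*[y*z]≈0 y≈0 = trans (*-congˡ (trans (*-congʳ y≈0) (zeroˡ _))) (zeroʳ _)

  -- L₁ pt 0 computes to (if inCone pt ∧ (pt ==P (+ 0 , + 1)) then 1# else 0#) + 0#.

  forbiddenStep-split : ∀ n pt e →
    firstStepWeight false pt SE * count false n (move pt SE) e ≈
    firstStepWeight true pt SE * count false n (move pt SE) e + wt SE * (L₁ pt 0 * C̃ n e)
  forbiddenStep-split n pt e with inCone pt | inS SE | pt ==P (+ 0 , + 1) in at-01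
  ... | false | _     | _     = x≈x+z (x*[y*z]≈0 (+-identityʳ 0#))
  ... | true  | false | _     = x≈x+z (zeroˡ _)
  ... | true  | true  | false = x≈x+z (x*[y*z]≈0 (+-identityʳ 0#))
  ... | true  | true  | true  = begin
    w SE * count false n (move pt SE) e    ≡⟨ ≡.cong (λ q → w SE * count false n q e) (move-forbidden pt at-01) ⟩
    w SE * C̃ n e                          ≈⟨ *-congˡ (*-identityˡ _) ⟨
    w SE * (1# * C̃ n e)                   ≈⟨ *-congˡ (*-congʳ (+-identityʳ 1#)) ⟨
    w SE * ((1# + 0#) * C̃ n e)            ≈⟨ +-identityˡ _ ⟨
    0# + w SE * ((1# + 0#) * C̃ n e)       ≈⟨ +-congʳ (zeroˡ _) ⟨
    0# * count false n (move pt SE) e + w SE * ((1# + 0#) * C̃ n e) ∎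

  firstSteps-forbidden-split : ∀ n pt e →
    sumOver allSteps (λ s → firstStepWeight false pt s * count false n (move pt s) e) ≈
    sumOver allSteps (λ s → firstStepWeight true pt s * count false n (move pt s) e)
      + wt SE * (L₁ pt 0 * C̃ n e)
  firstSteps-forbidden-split n pt e =
    trans (sumOver-cong allSteps split)
      (trans (sumOver-+ allSteps (λ s → firstStepWeight true pt s * count false n (move pt s) e) extra)
             (+-congˡ extra-sum))
    where
    K : Carrier
    K = wt SE * (L₁ pt 0 * C̃ n e)
    extra : Step → Carrier
    extra s = if isSE s then K else 0#
    -- Only SE can be forbidden, so for the other steps both weights coincide definitionally.
    split : ∀ s → firstStepWeight false pt s * count false n (move pt s) e ≈
                  firstStepWeight true pt s * count false n (move pt s) e + extra s
    split E  = sym (+-identityʳ _)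
    split NE = sym (+-identityʳ _)
    split N  = sym (+-identityʳ _)
    split NW = sym (+-identityʳ _)
    split W  = sym (+-identityʳ _)
    split SW = sym (+-identityʳ _)
    split S  = sym (+-identityʳ _)
    split SE = forbiddenStep-split n pt e
    extra-sum : sumOver allSteps extra ≈ K
    extra-sum = trans (+-identityˡ _) (trans (+-identityˡ _) (trans (+-identityˡ _) (trans (+-identityˡ _)
                  (trans (+-identityˡ _) (trans (+-identityˡ _) (trans (+-identityˡ _) (+-identityʳ _)))))))

  sumBelow≡tL₁C̃ : ∀ n pt e → sumBelow n (λ k → L₁ pt k * C̃ (n ∸ suc k) e) ≡ tL₁C̃ pt n e
  sumBelow≡tL₁C̃ zero    pt e = ≡.refl
  sumBelow≡tL₁C̃ (suc n) pt e = ≡.refl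

  tL₁C̃-suc : ∀ n pt e →
    tL₁C̃ pt (suc n) e ≈
    L₁ pt 0 * C̃ n e + sumOver allSteps (λ s → firstStepWeight true pt s * tL₁C̃ (move pt s) n e)
  tL₁C̃-suc n pt e = begin
    sumBelow (suc n) (λ k → L₁ pt k * C̃ (n ∸ k) e)
      ≈⟨ sumBelow-suc n (λ k → L₁ pt k * C̃ (n ∸ k) e) ⟩
    L₁ pt 0 * C̃ n e + sumBelow n (λ k → L₁ pt (suc k) * C̃ (n ∸ suc k) e)
      ≈⟨ +-congˡ (sumBelow-cong n (λ k → first-step k)) ⟩
    L₁ pt 0 * C̃ n e + sumBelow n (λ k → sumOver allSteps (λ s → a s * (L₁ (move pt s) k * C̃ (n ∸ suc k) e)))
      ≈⟨ +-congˡ (sumBelow-sumOver allSteps n (λ s k → a s * (L₁ (move pt s) k * C̃ (n ∸ suc k) e))) ⟩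
    L₁ pt 0 * C̃ n e + sumOver allSteps (λ s → sumBelow n (λ k → a s * (L₁ (move pt s) k * C̃ (n ∸ suc k) e)))
      ≈⟨ +-congˡ (sumOver-cong allSteps λ s →
           trans (sumBelow-*ˡ n (a s) (λ k → L₁ (move pt s) k * C̃ (n ∸ suc k) e))
                 (*-congˡ (reflexive (sumBelow≡tL₁C̃ n (move pt s) e)))) ⟩
    L₁ pt 0 * C̃ n e + sumOver allSteps (λ s → a s * tL₁C̃ (move pt s) n e) ∎
    where
    a : Step → Carrier
    a = firstStepWeight true pt
    first-step : ∀ k →
                 L₁ pt (suc k) * C̃ (n ∸ suc k) e ≈
                 sumOver allSteps (λ s → a s * (L₁ (move pt s) k * C̃ (n ∸ suc k) e))
    first-step k = begin
      L₁ pt (suc k) * C̃ (n ∸ suc k) e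
        ≈⟨ *-congʳ (count-suc true k pt (+ 0 , + 1)) ⟩
      sumOver allSteps (λ s → a s * L₁ (move pt s) k) * C̃ (n ∸ suc k) e
        ≈⟨ sumOver-*ʳ allSteps (C̃ (n ∸ suc k) e) (λ s → a s * L₁ (move pt s) k) ⟨
      sumOver allSteps (λ s → a s * L₁ (move pt s) k * C̃ (n ∸ suc k) e)
        ≈⟨ sumOver-cong allSteps (λ s → *-assoc (a s) (L₁ (move pt s) k) (C̃ (n ∸ suc k) e)) ⟩
      sumOver allSteps (λ s → a s * (L₁ (move pt s) k * C̃ (n ∸ suc k) e)) ∎

  x-yz≈[x+yu]-y[u+z] : ∀ x y z u → x - y * z ≈ (x + y * u) - y * (u + z)
  x-yz≈[x+yu]-y[u+z] x y z u = sym (begin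
    (x + y * u) - y * (u + z)            ≈⟨ +-congˡ (-‿cong (distribˡ y u z)) ⟩
    (x + y * u) - (y * u + y * z)        ≈⟨ +-congˡ (-‿+-comm (y * u) (y * z)) ⟨
    (x + y * u) + (- (y * u) - y * z)    ≈⟨ +-assoc x _ _ ⟩
    x + (y * u + (- (y * u) - y * z))    ≈⟨ +-congˡ (+-assoc (y * u) _ _) ⟨
    x + ((y * u - y * u) - y * z)        ≈⟨ +-congˡ (+-congʳ (-‿inverseʳ (y * u))) ⟩
    x + (0# - y * z)                     ≈⟨ +-congˡ (+-identityˡ _) ⟩
    x - y * z                            ∎)

  count-avoiding : ∀ n pt e → count true n pt e ≈ count false n pt e - wt SE * tL₁C̃ pt n e
  count-avoiding zero    pt e =
    sym (trans (+-congˡ (trans (-‿cong (zeroʳ (wt SE))) -0#≈0#)) (+-identityʳ _))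
  count-avoiding (suc n) pt e = begin
    count true (suc n) pt e
      ≈⟨ count-suc true n pt e ⟩
    sumOver allSteps (λ s → a s * count true n (move pt s) e)
      ≈⟨ sumOver-cong allSteps (λ s → *-congˡ {a s} (count-avoiding n (move pt s) e)) ⟩
    sumOver allSteps (λ s → a s * (X s - wt SE * Y s))
      ≈⟨ sumOver-cong allSteps (λ s → trans (x[y-z]≈xy-xz (a s) (X s) _)
                                             (+-congˡ (-‿cong (x∙yz≈y∙xz (a s) (wt SE) (Y s))))) ⟩
    sumOver allSteps (λ s → a s * X s - wt SE * (a s * Y s))
      ≈⟨ sumOver-- allSteps (λ s → a s * X s) (λ s → wt SE * (a s * Y s)) ⟩
    sumOver allSteps (λ s → a s * X s) - sumOver allSteps (λ s → wt SE * (a s * Y s))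
      ≈⟨ +-congˡ (-‿cong (sumOver-*ˡ allSteps (wt SE) (λ s → a s * Y s))) ⟩
    sumOver allSteps (λ s → a s * X s) - wt SE * sumOver allSteps (λ s → a s * Y s)
      ≈⟨ x-yz≈[x+yu]-y[u+z] _ (wt SE) _ (L₁ pt 0 * C̃ n e) ⟩
    (sumOver allSteps (λ s → a s * X s) + wt SE * (L₁ pt 0 * C̃ n e))
      - wt SE * (L₁ pt 0 * C̃ n e + sumOver allSteps (λ s → a s * Y s))
      ≈⟨ +-cong (firstSteps-forbidden-split n pt e) (-‿cong (*-congˡ (tL₁C̃-suc n pt e))) ⟨
    sumOver allSteps (λ s → firstStepWeight false pt s * X s) - wt SE * tL₁C̃ pt (suc n) e
      ≈⟨ +-congʳ (count-suc false n pt e) ⟨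
    count false (suc n) pt e - wt SE * tL₁C̃ pt (suc n) e ∎
    where
    a X Y : Step → Carrier
    a = firstStepWeight true pt
    X s = count false n (move pt s) e
    Y s = tL₁C̃ (move pt s) n e

-- Splitting on n lets coefTL1Ct unfold to tL₁C̃.
proposition4p21 : {c ℓ : Level} (R : CommutativeRing c ℓ)
    (inS : Step → Bool) (w : Step → CommutativeRing.Carrier R)
    (p q : ℕ) → 0 < p →
    (n : ℕ) (i j : ℤ) →
    CommutativeRing._≈_ R (Walks.coefL R inS w p q n i j)
      (CommutativeRing._-_ R (Walks.coefC R inS w p q n i j)
        (CommutativeRing._*_ R (Walks.wt R inS w SE) (Walks.coefTL1Ct R inS w p q n i j)))
proposition4p21 R inS w p q _ zero    i j = WalkDecomposition.count-avoiding R inS w zero (+ p , + q) (i , j)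
proposition4p21 R inS w p q _ (suc n) i j = WalkDecomposition.count-avoiding R inS w (suc n) (+ p , + q) (i , j)
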